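{- Let $m_1,m_2,\dots,m_t$ be positive integers with $m_1=\max\{m_i\}_{i=1}^t$, and let $G=K_{m_1,m_2,\dots,m_t}$ be the complete multipartite graph whose $i$-th part has $m_i$ vertices. Then: (1) any edge connecting two vertices in a part of order $m_1$ is forbidden for $G$; (2) any edge connecting two vertices in any part of order $m_i$ with $i\neq 1$ is good for $G$; (3) $\mu(K_{m_1,m_2,\dots,m_t})=\sum_{i=2}^{t}\dfrac{(m_i-1)m_i}{2}$.
   Context: A $k$-ranking of a graph $G$ is a labeling $f:V(G)\to\{1,\dots,k\}$ such that whenever $f(u)=f(v)$ for distinct $u,v$, every $u$–$v$ path contains a vertex $w$ with $f(w)>f(u)$; the rank number $\chi_r(G)$ is the smallest $k$ for which $G$ has a $k$-ranking. An edge $e$ on $V(G)$ not in $G$ is good for $G$ if $\chi_r(G\cup\{e\})=\chi_r(G)$ and forbidden if $\chi_r(G\cup\{e\})>\chi_r(G)$. $\mu(G)$ denotes the maximum cardinality of a set $H$ of edges on $V(G)$, not in $G$, such that $\chi_r(G\cup H)=\chi_r(G)$.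
   Formalization: Part (1) carries the extra hypothesis that $m_i < m_1$ for every i ≠ 1, so the part of order m₁ is the only part of that order. The statement above fails without it. -}

module Defs where

open import Data.Nat using (ℕ; zero; suc; _≤_; _<_; _∸_; _*_; _/_)
open import Data.Fin using (Fin)
open import Data.Fin.Base using () renaming (zero to fzero; suc to fsuc)
open import Data.List using (List; []; _∷_; length; map; allFin)
open import Data.Nat.ListAction using (sum)
open import Data.List.Relation.Unary.Any using (Any)
open import Data.List.Relation.Unary.All using (All)
open import Data.List.Relation.Unary.AllPairs using (AllPairs)
open import Data.List.Relation.Unary.Unique.Propositional using (Unique)
open import Data.List.Membership.Propositional using (_∈_)
open import Data.Product using (Σ; ∃; _×_; _,_; swap)
open import Data.Sum using (_⊎_)
open import Relation.Binary.PropositionalEquality using (_≡_; _≢_)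
open import Relation.Nullary using (¬_)

Graph : Set → Set₁
Graph V = V → V → Set

module _ {V : Set} where

  data Walk (G : Graph V) : V → V → List V → Set where
    stop : ∀ {u} → Walk G u u (u ∷ [])
    step : ∀ {u w v p} → G u w → Walk G w v p → Walk G u v (u ∷ p)

  Path : Graph V → V → V → List V → Set
  Path G u v p = Walk G u v p × Unique p

  IsRanking : Graph V → ℕ → (V → ℕ) → Set
  IsRanking G k f =
    (∀ v → 1 ≤ f v × f v ≤ k) ×
    (∀ u v → u ≢ v → f u ≡ f v → ∀ p → Path G u v p →
       Any (λ w → f u < f w) p)

  HasRanking : Graph V → ℕ → Set
  HasRanking G k = ∃ λ (f : V → ℕ) → IsRanking G k f

  RankNumber : Graph V → ℕ → Set
  RankNumber G k = HasRanking G k × (∀ j → HasRanking G j → k ≤ j)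

  _∪E_ : Graph V → List (V × V) → Graph V
  (G ∪E H) u v = G u v ⊎ ((u , v) ∈ H ⊎ (v , u) ∈ H)

  NonEdgeSet : Graph V → List (V × V) → Set
  NonEdgeSet G H =
    All (λ e → Σ.proj₁ e ≢ Σ.proj₂ e × ¬ G (Σ.proj₁ e) (Σ.proj₂ e)) H ×
    AllPairs (λ e e′ → e ≢ e′ × e ≢ swap e′) H

  SameRank : Graph V → Graph V → Set
  SameRank G G′ = ∃ λ k → RankNumber G k × RankNumber G′ k

  Good : Graph V → V × V → Set
  Good G e = SameRank G (G ∪E (e ∷ []))

  Forbidden : Graph V → V × V → Set
  Forbidden G e = ∃ λ k → ∃ λ k′ →
    RankNumber G k × RankNumber (G ∪E (e ∷ [])) k′ × k < k′

  IsMu : Graph V → ℕ → Set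
  IsMu G μ =
    (∃ λ H → NonEdgeSet G H × length H ≡ μ × SameRank G (G ∪E H)) ×
    (∀ H → NonEdgeSet G H → SameRank G (G ∪E H) → length H ≤ μ)

-- Complete multipartite graph K_{m_1,…,m_t}, t = suc s; part i has m i vertices,
-- part fzero is the paper's part 1.
MVertex : (s : ℕ) → (Fin (suc s) → ℕ) → Set
MVertex s m = Σ (Fin (suc s)) (λ i → Fin (m i))

K : (s : ℕ) (m : Fin (suc s) → ℕ) → Graph (MVertex s m)
K s m (i , _) (j , _) = i ≢ j

muFormula : (s : ℕ) → (Fin (suc s) → ℕ) → ℕ
muFormula s m = sum (map (λ i → ((m (fsuc i) ∸ 1) * m (fsuc i)) / 2) (allFin s))

-- In a ranking of K_{m₁,…,m_t} equal labels only occur inside a part, and all repeated labels lie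
-- in a single part P: a repeated label on x, y in another part, together with a lowest-labelled
-- vertex v, would give a path x – v – y whose middle label is not higher.  So every vertex outside
-- P has a label of its own and P needs at least one more, whence χ_r ≥ 1 + Σ_{i≠P} m_i ≥
-- 1 + Σ_{i≥2} m_i; labelling part 1 by 1 and all other vertices distinctly attains the bound, and
-- stays a ranking when edges are added inside parts 2, …, t.  An edge inside the strictly largest
-- part 1 forces either two labels in P = part 1 or a smaller part P, so the rank increases (by one:
-- give an endpoint a fresh top label).  If a set H of added edges keeps the rank, then P is at
-- least as large as part 1 and contains no edge of H, so the edges of H lie inside the parts other
-- than P and |H| ≤ Σ_{i≠P} C(m_i,2) ≤ Σ_{i≥2} C(m_i,2); all edges inside parts 2, …, t attain this.

module Submission where

open import Defs
open import Data.Nat using (ℕ; suc; _≤_; _<_)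
open import Data.Fin using (Fin; zero)
open import Data.Product using (_×_; _,_)
open import Relation.Binary.PropositionalEquality using (_≡_; _≢_)

open import Data.Empty using (⊥-elim)
open import Data.Fin using (toℕ; fromℕ<; punchIn; _≟_) renaming (suc to fsuc)
open import Data.Fin.Properties
  using (toℕ<n; toℕ-injective; injective⇒≤; punchIn-injective; punchInᵢ≢i; punchIn-punchOut)
open import Data.List
  using (List; []; _∷_; _++_; length; map; concatMap; allFin; tabulate; applyUpTo; lookup)
open import Data.List.Extrema.Nat using (argmin; f[argmin]≤f[xs])
open import Data.List.Membership.Propositional using (_∈_; find; lose)
open import Data.List.Membership.Propositional.Properties
  using (∈-map⁺; ∈-map⁻; ∈-++⁺ˡ; ∈-++⁺ʳ; ∈-++⁻; ∈-lookup; ∈-allFin; ∈-applyUpTo⁺; ∈-concatMap⁺; ∈-concatMap⁻)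
open import Data.List.Properties
  using (length-++; length-map; length-tabulate; length-applyUpTo; map-tabulate; map-∘; map-cong)
open import Data.List.Relation.Binary.Subset.Propositional using (_⊆_)
open import Data.List.Relation.Unary.All as All using (All; []; _∷_)
import Data.List.Relation.Unary.All.Properties as All
open import Data.List.Relation.Unary.AllPairs as AllPairs using (AllPairs; []; _∷_)
import Data.List.Relation.Unary.AllPairs.Properties as AllPairs
open import Data.List.Relation.Unary.Any as Any using (here; there; index)
open import Data.List.Relation.Unary.Any.Properties using (lookup-index)
open import Data.List.Relation.Unary.Unique.Propositional using (Unique)
import Data.List.Relation.Unary.Unique.Propositional.Properties as Unique
open import Data.Nat using (z≤n; s≤s; _+_; _*_; _∸_; _/_)
open import Data.Nat.Combinatorics using (_C_; nC1≡n; nCk+nC[k+1]≡[n+1]C[k+1])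
open import Data.Nat.DivMod using (m*n/n≡m; /-monoˡ-≤)
open import Data.Nat.ListAction using (sum)
open import Data.Nat.Properties hiding (_≟_)
open import Algebra.Properties.CommutativeSemigroup +-commutativeSemigroup using (x∙yz≈y∙xz)
open import Data.Nat.Tactic.RingSolver using (solve-∀)
open import Data.Product as Product using (Σ-syntax; ∃-syntax; proj₁; proj₂; swap)
open import Data.Product.Properties using (≡-dec)
open import Data.Sum as Sum using (_⊎_; inj₁; inj₂)
open import Function using (_∘_; id)
open import Function.Definitions using (Injective)
open import Relation.Binary.Definitions using (DecidableEquality)
open import Relation.Binary.PropositionalEquality using (refl; sym; trans; cong; cong₂; subst; module ≡-Reasoning)
open import Relation.Nullary using (¬_; yes; no)
open import Relation.Nullary.Decidable using (decidable-stable)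

private variable
  A B : Set
  k : ℕ
  x y z : A
  xs ys p : List A
  G : Graph A
  H : List (A × A)
  f : A → ℕ

Unique-lookup-injective : Unique xs → ∀ {i j} → lookup xs i ≡ lookup xs j → i ≡ j
Unique-lookup-injective (_ ∷ _) {zero} {zero} _ = refl
Unique-lookup-injective (x∉xs ∷ _) {zero} {fsuc j} eq = ⊥-elim (All.lookup x∉xs (∈-lookup j) eq)
Unique-lookup-injective (x∉xs ∷ _) {fsuc i} {zero} eq = ⊥-elim (All.lookup x∉xs (∈-lookup i) (sym eq))
Unique-lookup-injective (_ ∷ xs!) {fsuc i} {fsuc j} eq = cong fsuc (Unique-lookup-injective xs! eq)

Unique⇒length≤ : Unique xs → xs ⊆ ys → length xs ≤ length ys
Unique⇒length≤ {xs = xs} {ys = ys} xs! xs⊆ys = injective⇒≤ position-injective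
  where
  position : Fin (length xs) → Fin (length ys)
  position i = index (xs⊆ys (∈-lookup i))

  lookup-position : ∀ i → lookup xs i ≡ lookup ys (position i)
  lookup-position i = lookup-index (xs⊆ys (∈-lookup i))

  position-injective : Injective _≡_ _≡_ position
  position-injective {i} {j} eq = Unique-lookup-injective xs! (begin
    lookup xs i            ≡⟨ lookup-position i ⟩
    lookup ys (position i) ≡⟨ cong (lookup ys) eq ⟩
    lookup ys (position j) ≡⟨ lookup-position j ⟨
    lookup xs j            ∎)
    where open ≡-Reasoning

AllPairs-map-∈ : ∀ {R S : A → A → Set} →
  (∀ {x y} → x ∈ xs → y ∈ xs → R x y → S x y) → AllPairs R xs → AllPairs S xs
AllPairs-map-∈ R⇒S [] = []
AllPairs-map-∈ R⇒S (Rx ∷ Rxs) =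
  All.tabulate (λ y∈ → R⇒S (here refl) (there y∈) (All.lookup Rx y∈)) ∷
  AllPairs-map-∈ (λ x∈ y∈ → R⇒S (there x∈) (there y∈)) Rxs

module _ {g : A → List B} where

  ∈-concatMap⁺′ : y ∈ g x → x ∈ xs → y ∈ concatMap g xs
  ∈-concatMap⁺′ y∈gx x∈xs = ∈-concatMap⁺ g (Any.map (λ { refl → y∈gx }) x∈xs)

  ∈-concatMap⁻′ : y ∈ concatMap g xs → ∃[ x ] x ∈ xs × y ∈ g x
  ∈-concatMap⁻′ = find ∘ ∈-concatMap⁻ g

  length-concatMap : ∀ xs → length (concatMap g xs) ≡ sum (map (length ∘ g) xs)
  length-concatMap [] = refl
  length-concatMap (x ∷ xs) = trans (length-++ (g x)) (cong (length (g x) +_) (length-concatMap xs))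

  AllPairs-concatMap⁺ : ∀ {R : B → B → Set} → (∀ x → AllPairs R (g x)) →
    (∀ {x x′ y y′} → x ≢ x′ → y ∈ g x → y′ ∈ g x′ → R y y′) →
    Unique xs → AllPairs R (concatMap g xs)
  AllPairs-concatMap⁺ within across xs! = AllPairs.concat⁺
    (All.map⁺ (All.tabulate (λ _ → within _)))
    (AllPairs.map⁺ (AllPairs.map (λ x≢x′ → All.tabulate λ y∈ → All.tabulate λ y′∈ → across x≢x′ y∈ y′∈)
                                 xs!))

∑ : ∀ {n} → (Fin n → ℕ) → ℕ
∑ {n} g = sum (map g (allFin n))

∑-punchIn : ∀ {n} (g : Fin (suc n) → ℕ) i → g i + ∑ (g ∘ punchIn i) ≡ g zero + ∑ (g ∘ fsuc)
∑-punchIn g i = begin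
  g i + ∑ (g ∘ punchIn i)              ≡⟨ cong (g i +_) (as-tabulate (g ∘ punchIn i)) ⟩
  g i + sum (tabulate (g ∘ punchIn i)) ≡⟨ tabulated g i ⟩
  g zero + sum (tabulate (g ∘ fsuc))   ≡⟨ cong (g zero +_) (as-tabulate (g ∘ fsuc)) ⟨
  g zero + ∑ (g ∘ fsuc)                ∎
  where
  open ≡-Reasoning
  as-tabulate : ∀ {n} (h : Fin n → ℕ) → ∑ h ≡ sum (tabulate h)
  as-tabulate h = cong sum (map-tabulate id h)

  tabulated : ∀ {n} (g : Fin (suc n) → ℕ) i →
    g i + sum (tabulate (g ∘ punchIn i)) ≡ g zero + sum (tabulate (g ∘ fsuc))
  tabulated g zero = refl
  tabulated {suc n} g (fsuc i) = begin
    g (fsuc i) + (g zero + sum (tabulate (g ∘ fsuc ∘ punchIn i))) ≡⟨ x∙yz≈y∙xz (g (fsuc i)) (g zero) _ ⟩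
    g zero + (g (fsuc i) + sum (tabulate (g ∘ fsuc ∘ punchIn i))) ≡⟨ cong (g zero +_) (tabulated (g ∘ fsuc) i) ⟩
    g zero + (g (fsuc zero) + sum (tabulate (g ∘ fsuc ∘ fsuc)))   ∎

module _ {n} (g : Fin (suc n) → ℕ) {i : Fin (suc n)} where
  open ≤-Reasoning

  ∑-punchIn-≤ : g zero ≤ g i → ∑ (g ∘ punchIn i) ≤ ∑ (g ∘ fsuc)
  ∑-punchIn-≤ le = +-cancelˡ-≤ (g i) _ _ (begin
    g i + ∑ (g ∘ punchIn i) ≡⟨ ∑-punchIn g i ⟩
    g zero + ∑ (g ∘ fsuc)   ≤⟨ +-monoˡ-≤ _ le ⟩
    g i + ∑ (g ∘ fsuc)      ∎)

  ∑-punchIn-≥ : g i ≤ g zero → ∑ (g ∘ fsuc) ≤ ∑ (g ∘ punchIn i)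
  ∑-punchIn-≥ le = +-cancelˡ-≤ (g zero) _ _ (begin
    g zero + ∑ (g ∘ fsuc)   ≡⟨ ∑-punchIn g i ⟨
    g i + ∑ (g ∘ punchIn i) ≤⟨ +-monoˡ-≤ _ le ⟩
    g zero + ∑ (g ∘ punchIn i) ∎)

  ∑-punchIn-> : g i < g zero → ∑ (g ∘ fsuc) < ∑ (g ∘ punchIn i)
  ∑-punchIn-> lt = +-cancelˡ-< (g zero) _ _ (begin-strict
    g zero + ∑ (g ∘ fsuc)   ≡⟨ ∑-punchIn g i ⟨
    g i + ∑ (g ∘ punchIn i) <⟨ +-monoˡ-< _ lt ⟩
    g zero + ∑ (g ∘ punchIn i) ∎)

C2-double : ∀ n → (n C 2) * 2 ≡ (n ∸ 1) * n
C2-double 0 = refl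
C2-double (suc n) = begin
  (suc n C 2) * 2     ≡⟨ cong (_* 2) (nCk+nC[k+1]≡[n+1]C[k+1] n 1) ⟨
  (n C 1 + n C 2) * 2 ≡⟨ cong (λ c → (c + n C 2) * 2) (nC1≡n n) ⟩
  (n + n C 2) * 2     ≡⟨ *-distribʳ-+ 2 n (n C 2) ⟩
  n * 2 + (n C 2) * 2 ≡⟨ cong (n * 2 +_) (C2-double n) ⟩
  n * 2 + (n ∸ 1) * n ≡⟨ shift n ⟩
  n * suc n           ∎
  where
  open ≡-Reasoning
  shift : ∀ n → n * 2 + (n ∸ 1) * n ≡ n * suc n
  shift 0 = refl
  shift (suc n) = expand n
    where
    expand : ∀ n → suc n * 2 + n * suc n ≡ suc n * suc (suc n)
    expand = solve-∀

nC2≡[n∸1]*n/2 : ∀ n → n C 2 ≡ ((n ∸ 1) * n) / 2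
nC2≡[n∸1]*n/2 n = trans (sym (m*n/n≡m (n C 2) 2)) (cong (_/ 2) (C2-double n))

C2-mono : ∀ {m n} → m ≤ n → m C 2 ≤ n C 2
C2-mono {m} {n} m≤n = begin
  m C 2             ≡⟨ nC2≡[n∸1]*n/2 m ⟩
  ((m ∸ 1) * m) / 2 ≤⟨ /-monoˡ-≤ 2 (*-mono-≤ (∸-monoˡ-≤ 1 m≤n) m≤n) ⟩
  ((n ∸ 1) * n) / 2 ≡⟨ nC2≡[n∸1]*n/2 n ⟨
  n C 2             ∎
  where open ≤-Reasoning

_≢ₑ_ : A × A → A × A → Set
e ≢ₑ e′ = e ≢ e′ × e ≢ swap e′

pairs : List A → List (A × A)
pairs [] = []
pairs (x ∷ xs) = map (x ,_) xs ++ pairs xs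

length-pairs : ∀ (xs : List A) → length (pairs xs) ≡ length xs C 2
length-pairs [] = refl
length-pairs (x ∷ xs) = begin
  length (map (x ,_) xs ++ pairs xs)         ≡⟨ length-++ (map (x ,_) xs) ⟩
  length (map (x ,_) xs) + length (pairs xs) ≡⟨ cong₂ _+_ (trans (length-map _ xs) (sym (nC1≡n _)))
                                                            (length-pairs xs) ⟩
  length xs C 1 + length xs C 2              ≡⟨ nCk+nC[k+1]≡[n+1]C[k+1] (length xs) 1 ⟩
  suc (length xs) C 2                        ∎
  where open ≡-Reasoning

∈-pairs⁻ : ∀ {e : A × A} → e ∈ pairs xs → proj₁ e ∈ xs × proj₂ e ∈ xs
∈-pairs⁻ {xs = x ∷ xs} e∈ with ∈-++⁻ (map (x ,_) xs) e∈
... | inj₂ e∈rest = Product.map there there (∈-pairs⁻ e∈rest)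
... | inj₁ e∈head with ∈-map⁻ (x ,_) e∈head
...   | _ , y∈ , refl = here refl , there y∈

∈-pairs⁺ : ∀ {x y : A} {xs} → x ∈ xs → y ∈ xs → x ≢ y → (x , y) ∈ pairs xs ⊎ (y , x) ∈ pairs xs
∈-pairs⁺ (here refl) (here refl) x≢y = ⊥-elim (x≢y refl)
∈-pairs⁺ (here refl) (there y∈) _ = inj₁ (∈-++⁺ˡ (∈-map⁺ _ y∈))
∈-pairs⁺ (there x∈) (here refl) _ = inj₂ (∈-++⁺ˡ (∈-map⁺ _ x∈))
∈-pairs⁺ {xs = z ∷ zs} (there x∈) (there y∈) x≢y =
  Sum.map (∈-++⁺ʳ (map (z ,_) zs)) (∈-++⁺ʳ (map (z ,_) zs)) (∈-pairs⁺ x∈ y∈ x≢y)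

pairs-irreflexive : Unique xs → All (λ e → proj₁ e ≢ proj₂ e) (pairs xs)
pairs-irreflexive [] = []
pairs-irreflexive (x∉xs ∷ xs!) = All.++⁺ (All.map⁺ x∉xs) (pairs-irreflexive xs!)

pairs-≢ₑ : Unique xs → AllPairs _≢ₑ_ (pairs xs)
pairs-≢ₑ [] = []
pairs-≢ₑ (x∉xs ∷ xs!) = AllPairs.++⁺
  (AllPairs.map⁺ (AllPairs-map-∈ (λ _ y′∈ y≢y′ → y≢y′ ∘ cong proj₂ , All.lookup x∉xs y′∈ ∘ cong proj₁)
                                 xs!))
  (pairs-≢ₑ xs!)
  (All.map⁺ (All.tabulate λ _ → All.tabulate λ e′∈ →
    All.lookup x∉xs (proj₁ (∈-pairs⁻ e′∈)) ∘ cong proj₁ ,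
    All.lookup x∉xs (proj₂ (∈-pairs⁻ e′∈)) ∘ cong proj₁))

module _ (_≟ᴬ_ : DecidableEquality A) where
  open import Data.List.Membership.DecPropositional (≡-dec _≟ᴬ_ _≟ᴬ_) using (_∈?_)

  -- Orient each pair of es as it occurs in fs; distinct unordered pairs stay distinct.
  length≤-up-to-swap : ∀ {es fs : List (A × A)} → AllPairs _≢ₑ_ es →
    (∀ {e} → e ∈ es → e ∈ fs ⊎ swap e ∈ fs) → length es ≤ length fs
  length≤-up-to-swap {es} {fs} es-distinct es⊆fs = begin
    length es              ≡⟨ length-map orient es ⟨
    length (map orient es) ≤⟨ Unique⇒length≤ oriented-unique oriented⊆fs ⟩
    length fs              ∎
    where
    open ≤-Reasoning
    orient : A × A → A × A
    orient e with e ∈? fs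
    ... | yes _ = e
    ... | no _ = swap e

    orient-∈ : ∀ {e} → e ∈ fs ⊎ swap e ∈ fs → orient e ∈ fs
    orient-∈ {e} e∈ with e ∈? fs
    ... | yes e∈fs = e∈fs
    ... | no e∉fs = Sum.[ ⊥-elim ∘ e∉fs , id ] e∈

    oriented⊆fs : map orient es ⊆ fs
    oriented⊆fs o∈ with ∈-map⁻ orient o∈
    ... | _ , e∈ , refl = orient-∈ (es⊆fs e∈)

    orient-either : ∀ e → orient e ≡ e ⊎ orient e ≡ swap e
    orient-either e with e ∈? fs
    ... | yes _ = inj₁ refl
    ... | no _ = inj₂ refl

    orient-injective : ∀ {e e′} → e ≢ₑ e′ → orient e ≢ orient e′
    orient-injective {e} {e′} (e≢e′ , e≢swap-e′) eq with orient-either e | orient-either e′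
    ... | inj₁ p | inj₁ q = e≢e′ (trans (sym p) (trans eq q))
    ... | inj₁ p | inj₂ q = e≢swap-e′ (trans (sym p) (trans eq q))
    ... | inj₂ p | inj₁ q = e≢swap-e′ (cong swap (trans (sym p) (trans eq q)))
    ... | inj₂ p | inj₂ q = e≢e′ (cong swap (trans (sym p) (trans eq q)))

    oriented-unique : Unique (map orient es)
    oriented-unique = AllPairs.map⁺ (AllPairs.map orient-injective es-distinct)

walk-start : Walk G x y p → x ∈ p
walk-start stop = here refl
walk-start (step _ _) = here refl

Walk-∪E⁺ : Walk G x y p → Walk (G ∪E H) x y p
Walk-∪E⁺ stop = stop
Walk-∪E⁺ (step g rest) = step (inj₁ g) (Walk-∪E⁺ rest)

IsRanking-∪E⁻ : IsRanking (G ∪E H) k f → IsRanking G k f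
IsRanking-∪E⁻ (bounded , ranked) =
  bounded , λ u v u≢v eq p (walk , p!) → ranked u v u≢v eq p (Walk-∪E⁺ walk , p!)

adjacent⇒labels-≢ : IsRanking G k f → G x y → x ≢ y → f x ≢ f y
adjacent⇒labels-≢ {x = x} {y = y} (_ , ranked) g x≢y eq
  with ranked x y x≢y eq (x ∷ y ∷ []) (step g stop , (x≢y ∷ []) ∷ [] ∷ [])
... | here fx<fx = <-irrefl refl fx<fx
... | there (here fx<fy) = <-irrefl eq fx<fy

equal-ends⇒middle-higher : IsRanking G k f → G x y → G y z →
  x ≢ y → x ≢ z → y ≢ z → f x ≡ f z → f x < f y
equal-ends⇒middle-higher {x = x} {y = y} {z = z} (_ , ranked) g₁ g₂ x≢y x≢z y≢z eq
  with ranked x z x≢z eq (x ∷ y ∷ z ∷ [])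
              (step g₁ (step g₂ stop) , (x≢y ∷ x≢z ∷ []) ∷ (y≢z ∷ []) ∷ [] ∷ [])
... | here fx<fx = ⊥-elim (<-irrefl refl fx<fx)
... | there (here fx<fy) = fx<fy
... | there (there (here fx<fz)) = ⊥-elim (<-irrefl eq fx<fz)

-- Every path between distinct vertices leaves its start through a neighbour.
isRanking-local : (∀ v → 1 ≤ f v × f v ≤ k) →
  (∀ u v → u ≢ v → f u ≡ f v → ∀ w → G u w → f u < f w) → IsRanking G k f
isRanking-local {f = f} {G = G} bounded twin-neighbours-higher = bounded , ranked
  where
  ranked : ∀ u v → u ≢ v → f u ≡ f v → ∀ p → Path G u v p → Any.Any (λ w → f u < f w) p
  ranked u _ u≢v eq _ (stop , _) = ⊥-elim (u≢v refl)
  ranked u v u≢v eq _ (step {w = w} g rest , _) =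
    there (lose (walk-start rest) (twin-neighbours-higher u v u≢v eq w g))

distinct-labels⇒length≤ : IsRanking G k f → AllPairs (λ x y → f x ≢ f y) xs → length xs ≤ k
distinct-labels⇒length≤ {k = k} {f = f} {xs = xs} (bounded , _) distinct = begin
  length xs                ≡⟨ length-map f xs ⟨
  length (map f xs)        ≤⟨ Unique⇒length≤ (AllPairs.map⁺ distinct) labels-in-range ⟩
  length (applyUpTo suc k) ≡⟨ length-applyUpTo suc k ⟩
  k                        ∎
  where
  open ≤-Reasoning
  in-range : ∀ {l} → 1 ≤ l × l ≤ k → l ∈ applyUpTo suc k
  in-range {suc l} (_ , l<k) = ∈-applyUpTo⁺ suc l<k

  labels-in-range : map f xs ⊆ applyUpTo suc k
  labels-in-range l∈ with ∈-map⁻ f l∈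
  ... | v , _ , refl = in-range (bounded v)

module Relabelling {V : Set} (_≟ⱽ_ : DecidableEquality V) where

  _[_≔_] : (V → ℕ) → V → ℕ → V → ℕ
  (f [ v ≔ l ]) u with u ≟ⱽ v
  ... | yes _ = l
  ... | no _ = f u

  ≔-same : ∀ f v l → (f [ v ≔ l ]) v ≡ l
  ≔-same f v l with v ≟ⱽ v
  ... | yes _ = refl
  ... | no v≢v = ⊥-elim (v≢v refl)

  ≔-other : ∀ f {v u} l → u ≢ v → (f [ v ≔ l ]) u ≡ f u
  ≔-other f {v} {u} l u≢v with u ≟ⱽ v
  ... | yes u≡v = ⊥-elim (u≢v u≡v)
  ... | no _ = refl

  IncidentTo : V → List (V × V) → Set
  IncidentTo v H = All (λ e → proj₁ e ≡ v ⊎ proj₂ e ≡ v) H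

  walk-through-or-within : ∀ {G v H} → IncidentTo v H → ∀ {x y p} →
    Walk (G ∪E H) x y p → v ∈ p ⊎ Walk G x y p
  walk-through-or-within {G} {v} {H} incident = go
    where
    on-walk : ∀ {x z y p} → x ≡ v ⊎ z ≡ v → Walk (G ∪E H) z y p → v ∈ x ∷ p
    on-walk (inj₁ refl) _ = here refl
    on-walk (inj₂ refl) rest = there (walk-start rest)

    go : ∀ {x y p} → Walk (G ∪E H) x y p → v ∈ p ⊎ Walk G x y p
    go stop = inj₂ stop
    go (step (inj₁ g) rest) = Sum.map there (step g) (go rest)
    go (step (inj₂ (inj₁ e∈H)) rest) = inj₁ (on-walk (All.lookup incident e∈H) rest)
    go (step (inj₂ (inj₂ e∈H)) rest) = inj₁ (on-walk (Sum.swap (All.lookup incident e∈H)) rest)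

  -- A fresh top label on v makes v separate every pair of twins, so edges at v cost nothing more.
  raise-isRanking : ∀ {G k f v H} → IsRanking G k f → IncidentTo v H →
    IsRanking (G ∪E H) (suc k) (f [ v ≔ suc k ])
  raise-isRanking {G} {k} {f} {v} {H} (bounded , ranked) incident = bounded′ , ranked′
    where
    f′ : V → ℕ
    f′ = f [ v ≔ suc k ]

    f≤f′ : ∀ u → f u ≤ f′ u
    f≤f′ u with u ≟ⱽ v
    ... | yes _ = m≤n⇒m≤1+n (proj₂ (bounded u))
    ... | no _ = ≤-refl

    below-top : ∀ {u} → u ≢ v → f′ u < suc k
    below-top {u} u≢v = subst (_< suc k) (sym (≔-other f (suc k) u≢v)) (s≤s (proj₂ (bounded u)))

    bounded′ : ∀ u → 1 ≤ f′ u × f′ u ≤ suc k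
    bounded′ u with u ≟ⱽ v
    ... | yes _ = s≤s z≤n , ≤-refl
    ... | no _ = proj₁ (bounded u) , m≤n⇒m≤1+n (proj₂ (bounded u))

    twin≢v : ∀ {u w} → u ≢ w → f′ u ≡ f′ w → u ≢ v
    twin≢v u≢w eq refl = <-irrefl (trans (sym eq) (≔-same f v (suc k))) (below-top (u≢w ∘ sym))

    ranked′ : ∀ u w → u ≢ w → f′ u ≡ f′ w → ∀ p → Path (G ∪E H) u w p → Any.Any (λ x → f′ u < f′ x) p
    ranked′ u w u≢w eq p (walk , p!) with walk-through-or-within incident walk
    ... | inj₁ v∈p = lose v∈p (subst (f′ u <_) (sym (≔-same f v (suc k))) (below-top u≢v))
      where u≢v = twin≢v u≢w eq
    ... | inj₂ walkᴳ = Any.map (λ {x} fu<fx → subst (_< f′ x) (sym f′u≡fu) (<-≤-trans fu<fx (f≤f′ x)))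
                               (ranked u w u≢w f-twins p (walkᴳ , p!))
      where
      f′u≡fu = ≔-other f (suc k) (twin≢v u≢w eq)
      f-twins = trans (sym f′u≡fu) (trans eq (≔-other f (suc k) (twin≢v (u≢w ∘ sym) (sym eq))))

module CompleteMultipartite (s : ℕ) (m : Fin (suc s) → ℕ)
  (nonempty : ∀ i → 1 ≤ m i) (largest₀ : ∀ i → m i ≤ m zero) where

  V : Set
  V = MVertex s m

  part : V → Fin (suc s)
  part = proj₁

  _≟ᵥ_ : DecidableEquality V
  _≟ᵥ_ = ≡-dec _≟_ _≟_

  open Relabelling _≟ᵥ_

  verticesOf : Fin (suc s) → List V
  verticesOf i = map (i ,_) (allFin (m i))

  verticesOf-unique : ∀ i → Unique (verticesOf i)
  verticesOf-unique i = Unique.map⁺ (λ { refl → refl }) (Unique.allFin⁺ (m i))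

  vertexOf : Fin (suc s) → V
  vertexOf i = i , fromℕ< (nonempty i)

  ∈-verticesOf⁺ : ∀ v → v ∈ verticesOf (part v)
  ∈-verticesOf⁺ (i , a) = ∈-map⁺ (i ,_) (∈-allFin a)

  ∈-verticesOf⁻ : ∀ {v i} → v ∈ verticesOf i → part v ≡ i
  ∈-verticesOf⁻ v∈ with ∈-map⁻ _ v∈
  ... | _ , _ , refl = refl

  ∈-pairs-verticesOf⁻ : ∀ {e i} → e ∈ pairs (verticesOf i) → part (proj₁ e) ≡ i × part (proj₂ e) ≡ i
  ∈-pairs-verticesOf⁻ e∈ = Product.map ∈-verticesOf⁻ ∈-verticesOf⁻ (∈-pairs⁻ e∈)

  length-verticesOf : ∀ i → length (verticesOf i) ≡ m i
  length-verticesOf i = trans (length-map _ (allFin (m i))) (length-tabulate id)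

  allVertices : List V
  allVertices = concatMap verticesOf (allFin (suc s))

  ∈-allVertices : ∀ v → v ∈ allVertices
  ∈-allVertices v = ∈-concatMap⁺′ (∈-verticesOf⁺ v) (∈-allFin (part v))

  partsExcept : Fin (suc s) → List (Fin (suc s))
  partsExcept i = map (punchIn i) (allFin s)

  partsExcept-unique : ∀ {i} → Unique (partsExcept i)
  partsExcept-unique {i} = Unique.map⁺ (punchIn-injective i _ _) (Unique.allFin⁺ s)

  ∈-partsExcept⁺ : ∀ {i j} → i ≢ j → j ∈ partsExcept i
  ∈-partsExcept⁺ i≢j = subst (_∈ _) (punchIn-punchOut i≢j) (∈-map⁺ _ (∈-allFin _))

  ∈-partsExcept⁻ : ∀ {i j} → j ∈ partsExcept i → j ≢ i
  ∈-partsExcept⁻ j∈ with ∈-map⁻ _ j∈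
  ... | j′ , _ , refl = punchInᵢ≢i _ j′

  length-concatMap-partsExcept : ∀ {g : Fin (suc s) → List B} {h : Fin (suc s) → ℕ} →
    (∀ j → length (g j) ≡ h j) → ∀ i → length (concatMap g (partsExcept i)) ≡ ∑ (h ∘ punchIn i)
  length-concatMap-partsExcept {g = g} {h = h} length-g i = begin
    length (concatMap g (partsExcept i))                  ≡⟨ length-concatMap (partsExcept i) ⟩
    sum (map (length ∘ g) (map (punchIn i) (allFin s)))   ≡⟨ cong sum (map-∘ (allFin s)) ⟨
    sum (map (length ∘ g ∘ punchIn i) (allFin s))         ≡⟨ cong sum (map-cong (length-g ∘ punchIn i) (allFin s)) ⟩
    ∑ (h ∘ punchIn i)                                     ∎
    where open ≡-Reasoning

  verticesOutside : Fin (suc s) → List V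
  verticesOutside i = concatMap verticesOf (partsExcept i)

  outsideSize : Fin (suc s) → ℕ
  outsideSize i = ∑ (m ∘ punchIn i)

  length-verticesOutside : ∀ i → length (verticesOutside i) ≡ outsideSize i
  length-verticesOutside = length-concatMap-partsExcept length-verticesOf

  verticesOutside-unique : ∀ i → Unique (verticesOutside i)
  verticesOutside-unique i = AllPairs-concatMap⁺ verticesOf-unique
    (λ j≢j′ v∈ v′∈ v≡v′ →
      j≢j′ (trans (sym (∈-verticesOf⁻ v∈)) (trans (cong part v≡v′) (∈-verticesOf⁻ v′∈))))
    partsExcept-unique

  ∈-verticesOutside⁺ : ∀ {i v} → i ≢ part v → v ∈ verticesOutside i
  ∈-verticesOutside⁺ i≢ = ∈-concatMap⁺′ (∈-verticesOf⁺ _) (∈-partsExcept⁺ i≢)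

  ∈-verticesOutside⁻ : ∀ {i v} → v ∈ verticesOutside i → part v ≢ i
  ∈-verticesOutside⁻ v∈ with ∈-concatMap⁻′ v∈
  ... | _ , j∈ , v∈j = subst (_≢ _) (sym (∈-verticesOf⁻ v∈j)) (∈-partsExcept⁻ j∈)

  χ : ℕ
  χ = suc (outsideSize zero)

  outsideSize-≥ : ∀ i → outsideSize zero ≤ outsideSize i
  outsideSize-≥ i = ∑-punchIn-≥ m (largest₀ i)

  outsideSize-> : ∀ {i} → m i < m zero → outsideSize zero < outsideSize i
  outsideSize-> = ∑-punchIn-> m

  TwinsWithin : (V → ℕ) → Fin (suc s) → Set
  TwinsWithin f i = ∀ {u v} → u ≢ v → f u ≡ f v → part u ≡ i

  module _ {k f} (ranking : IsRanking (K s m) k f) where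

    twins-same-part : ∀ {u v} → u ≢ v → f u ≡ f v → part u ≡ part v
    twins-same-part {u} {v} u≢v eq =
      decidable-stable (part u ≟ part v) λ parts≢ → adjacent⇒labels-≢ ranking parts≢ u≢v eq

    twinsWithin-lowest : ∀ {v} → (∀ w → f v ≤ f w) → TwinsWithin f (part v)
    twinsWithin-lowest {v} lowest {x} {y} x≢y eq = decidable-stable (part x ≟ part v) λ x∉v →
      let y∉v = λ y∈v → x∉v (trans (twins-same-part x≢y eq) y∈v)
      in <⇒≱ (equal-ends⇒middle-higher ranking x∉v (y∉v ∘ sym) (x∉v ∘ cong part) x≢y
                (y∉v ∘ sym ∘ cong part) eq) (lowest x)

    twinsPart : Σ[ i ∈ Fin (suc s) ] TwinsWithin f i
    twinsPart = part lowest ,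
      twinsWithin-lowest (λ w → All.lookup (f[argmin]≤f[xs] (vertexOf zero) allVertices) (∈-allVertices w))
      where
      lowest : V
      lowest = argmin f (vertexOf zero) allVertices

    distinct-in-twinsPart+outside≤k : ∀ {i} → TwinsWithin f i → ∀ {T} → All (λ v → part v ≡ i) T →
      AllPairs (λ x y → f x ≢ f y) T → length T + outsideSize i ≤ k
    distinct-in-twinsPart+outside≤k {i} twins {T} T-inside T-distinct = begin
      length T + outsideSize i                  ≡⟨ cong (length T +_) (length-verticesOutside i) ⟨
      length T + length (verticesOutside i)     ≡⟨ length-++ T ⟨
      length (T ++ verticesOutside i)           ≤⟨ distinct-labels⇒length≤ ranking
                                                     (AllPairs.++⁺ T-distinct outside-distinct across) ⟩
      k                                         ∎
      where
      open ≤-Reasoning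
      outside-distinct : AllPairs (λ x y → f x ≢ f y) (verticesOutside i)
      outside-distinct =
        AllPairs-map-∈ (λ x∈ _ x≢y eq → ∈-verticesOutside⁻ x∈ (twins x≢y eq)) (verticesOutside-unique i)

      across : All (λ x → All (λ y → f x ≢ f y) (verticesOutside i)) T
      across = All.map (λ x∈i → All.tabulate λ y∈ eq →
        let y≢x = λ y≡x → ∈-verticesOutside⁻ y∈ (trans (cong part y≡x) x∈i)
        in ∈-verticesOutside⁻ y∈ (twins y≢x (sym eq))) T-inside

    χ≤k : χ ≤ k
    χ≤k = let (i , twins) = twinsPart in
      ≤-trans (s≤s (outsideSize-≥ i))
              (distinct-in-twinsPart+outside≤k twins {T = vertexOf i ∷ []} (refl ∷ []) ([] ∷ []))

    small-twinsPart⇒χ< : ∀ {i} → TwinsWithin f i → m i < m zero → χ < k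
    small-twinsPart⇒χ< {i} twins mi<m₀ =
      ≤-trans (s≤s (outsideSize-> mi<m₀))
              (distinct-in-twinsPart+outside≤k twins {T = vertexOf i ∷ []} (refl ∷ []) ([] ∷ []))

    split-twinsPart⇒χ< : ∀ {i x y} → TwinsWithin f i → part x ≡ i → part y ≡ i → f x ≢ f y → χ < k
    split-twinsPart⇒χ< {i} twins x∈i y∈i fx≢fy =
      ≤-trans (s≤s (s≤s (outsideSize-≥ i)))
              (distinct-in-twinsPart+outside≤k twins (x∈i ∷ y∈i ∷ []) ((fx≢fy ∷ []) ∷ [] ∷ []))

  ∈-verticesOutside₀ : ∀ j a → (fsuc j , a) ∈ verticesOutside zero
  ∈-verticesOutside₀ j a = ∈-verticesOutside⁺ {zero} λ ()

  position₀ : ∀ j a → Fin (length (verticesOutside zero))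
  position₀ j a = index (∈-verticesOutside₀ j a)

  baseLabel : V → ℕ
  baseLabel (zero , _) = 1
  baseLabel (fsuc j , a) = 2 + toℕ (position₀ j a)

  baseLabel-bounded : ∀ v → 1 ≤ baseLabel v × baseLabel v ≤ χ
  baseLabel-bounded (zero , _) = s≤s z≤n , s≤s z≤n
  baseLabel-bounded (fsuc j , a) =
    s≤s z≤n , s≤s (subst (toℕ (position₀ j a) <_) (length-verticesOutside zero) (toℕ<n (position₀ j a)))

  baseLabel-outside : ∀ {v} → part v ≢ zero → 1 < baseLabel v
  baseLabel-outside {zero , _} v∉0 = ⊥-elim (v∉0 refl)
  baseLabel-outside {fsuc _ , _} _ = s≤s (s≤s z≤n)

  baseLabel-twins : ∀ {u v} → u ≢ v → baseLabel u ≡ baseLabel v → part u ≡ zero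
  baseLabel-twins {zero , _} _ _ = refl
  baseLabel-twins {fsuc _ , _} {zero , _} _ ()
  baseLabel-twins {fsuc j , a} {fsuc j′ , a′} u≢v eq = ⊥-elim (u≢v (begin
    (fsuc j , a)                                     ≡⟨ lookup-index (∈-verticesOutside₀ j a) ⟩
    lookup (verticesOutside zero) (position₀ j a)    ≡⟨ cong (lookup (verticesOutside zero)) positions≡ ⟩
    lookup (verticesOutside zero) (position₀ j′ a′)  ≡⟨ lookup-index (∈-verticesOutside₀ j′ a′) ⟨
    (fsuc j′ , a′)                                   ∎))
    where
    open ≡-Reasoning
    positions≡ = toℕ-injective (suc-injective (suc-injective eq))

  OffPart : Fin (suc s) → V × V → Set
  OffPart i e = part (proj₁ e) ≢ i × part (proj₂ e) ≢ i

  baseLabel-ranks : ∀ {H} → All (OffPart zero) H → IsRanking (K s m ∪E H) χ baseLabel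
  baseLabel-ranks {H} off = isRanking-local baseLabel-bounded twins-see-higher
    where
    twins-see-higher : ∀ u v → u ≢ v → baseLabel u ≡ baseLabel v →
      ∀ w → (K s m ∪E H) u w → baseLabel u < baseLabel w
    twins-see-higher (i , a) v u≢v eq w edge with baseLabel-twins {i , a} {v} u≢v eq
    ... | refl with edge
    ...   | inj₁ parts≢ = baseLabel-outside (parts≢ ∘ sym)
    ...   | inj₂ (inj₁ uw∈H) = ⊥-elim (proj₁ (All.lookup off uw∈H) refl)
    ...   | inj₂ (inj₂ wu∈H) = ⊥-elim (proj₂ (All.lookup off wu∈H) refl)

  baseLabel-ranks-K : IsRanking (K s m) χ baseLabel
  baseLabel-ranks-K = IsRanking-∪E⁻ {H = []} (baseLabel-ranks [])

  rankNumber-K : RankNumber (K s m) χ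
  rankNumber-K = (baseLabel , baseLabel-ranks-K) , λ _ (_ , ranking) → χ≤k ranking

  rankNumber-∪E : ∀ {H} → All (OffPart zero) H → RankNumber (K s m ∪E H) χ
  rankNumber-∪E off = (baseLabel , baseLabel-ranks off) , λ _ (_ , ranking) → χ≤k (IsRanking-∪E⁻ ranking)

  offPart₀-good : ∀ {e} → OffPart zero e → Good (K s m) e
  offPart₀-good off = χ , rankNumber-K , rankNumber-∪E (off ∷ [])

  part₀-edge-forbidden : (∀ j → j ≢ zero → m j < m zero) → ∀ {a b} → a ≢ b →
    Forbidden (K s m) ((zero , a) , (zero , b))
  part₀-edge-forbidden strictly-largest₀ {a} {b} a≢b =
    χ , suc χ , rankNumber-K , ((raised , raise-isRanking baseLabel-ranks-K (inj₂ refl ∷ [])) , χ<rank) , ≤-refl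
    where
    e : V × V
    e = (zero , a) , (zero , b)

    raised : V → ℕ
    raised = baseLabel [ (zero , b) ≔ suc χ ]

    χ<rank : ∀ k → HasRanking (K s m ∪E (e ∷ [])) k → χ < k
    χ<rank k (f , ranking) with twinsPart (IsRanking-∪E⁻ ranking)
    ... | i , twins with i ≟ zero
    ...   | yes refl = split-twinsPart⇒χ< (IsRanking-∪E⁻ ranking) twins refl refl
                         (adjacent⇒labels-≢ ranking (inj₂ (inj₁ (here refl))) λ { refl → a≢b refl })
    ...   | no i≢0 = small-twinsPart⇒χ< (IsRanking-∪E⁻ ranking) twins (strictly-largest₀ i i≢0)

  largest-part-edge-forbidden : (∀ j → j ≢ zero → m j < m zero) → ∀ i → m i ≡ m zero →
    ∀ (a b : Fin (m i)) → a ≢ b → Forbidden (K s m) ((i , a) , (i , b))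
  largest-part-edge-forbidden strictly-largest₀ i mi≡m₀ a b a≢b
    with decidable-stable (i ≟ zero) (λ i≢0 → <-irrefl mi≡m₀ (strictly-largest₀ i i≢0))
  ... | refl = part₀-edge-forbidden strictly-largest₀ a≢b

  edgesOutside : Fin (suc s) → List (V × V)
  edgesOutside i = concatMap (pairs ∘ verticesOf) (partsExcept i)

  length-edgesOutside : ∀ i → length (edgesOutside i) ≡ ∑ (λ j → m (punchIn i j) C 2)
  length-edgesOutside = length-concatMap-partsExcept {g = pairs ∘ verticesOf}
    λ j → trans (length-pairs (verticesOf j)) (cong (_C 2) (length-verticesOf j))

  ∑C2≡muFormula : ∑ (λ j → m (fsuc j) C 2) ≡ muFormula s m
  ∑C2≡muFormula = cong sum (map-cong (λ j → nC2≡[n∸1]*n/2 (m (fsuc j))) (allFin s))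

  edgesOutside-offPart : ∀ i → All (OffPart i) (edgesOutside i)
  edgesOutside-offPart i = All.tabulate λ e∈ → case-part (∈-concatMap⁻′ e∈)
    where
    case-part : ∀ {e} → ∃[ j ] j ∈ partsExcept i × e ∈ pairs (verticesOf j) → OffPart i e
    case-part (j , j∈ , e∈) = let (p₁ , p₂) = ∈-pairs-verticesOf⁻ e∈ in
      subst (_≢ i) (sym p₁) (∈-partsExcept⁻ j∈) , subst (_≢ i) (sym p₂) (∈-partsExcept⁻ j∈)

  edgesOutside-nonEdgeSet : ∀ i → NonEdgeSet (K s m) (edgesOutside i)
  edgesOutside-nonEdgeSet i = All.tabulate loopless-nonedge ,
    AllPairs-concatMap⁺ (λ j → pairs-≢ₑ (verticesOf-unique j)) across partsExcept-unique
    where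
    loopless-nonedge : ∀ {e} → e ∈ edgesOutside i → proj₁ e ≢ proj₂ e × ¬ K s m (proj₁ e) (proj₂ e)
    loopless-nonedge e∈ with ∈-concatMap⁻′ {g = pairs ∘ verticesOf} {xs = partsExcept i} e∈
    ... | j , _ , e∈j = All.lookup (pairs-irreflexive (verticesOf-unique j)) e∈j ,
                        λ parts≢ → let (p₁ , p₂) = ∈-pairs-verticesOf⁻ e∈j in parts≢ (trans p₁ (sym p₂))

    across : ∀ {j j′ e e′} → j ≢ j′ → e ∈ pairs (verticesOf j) → e′ ∈ pairs (verticesOf j′) → e ≢ₑ e′
    across j≢j′ e∈ e′∈ =
      let (p₁ , _) = ∈-pairs-verticesOf⁻ e∈ ; (p′₁ , p′₂) = ∈-pairs-verticesOf⁻ e′∈ in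
      (λ eq → j≢j′ (trans (sym p₁) (trans (cong (part ∘ proj₁) eq) p′₁))) ,
      (λ eq → j≢j′ (trans (sym p₁) (trans (cong (part ∘ proj₁) eq) p′₂)))

  ∈-edgesOutside⁺ : ∀ {i x y} → x ≢ y → part x ≡ part y → i ≢ part x →
    (x , y) ∈ edgesOutside i ⊎ (y , x) ∈ edgesOutside i
  ∈-edgesOutside⁺ {i} {x} {y} x≢y same i≢x =
    Sum.map (λ xy∈ → ∈-concatMap⁺′ xy∈ part∈) (λ yx∈ → ∈-concatMap⁺′ yx∈ part∈)
      (∈-pairs⁺ (∈-verticesOf⁺ x) (subst (λ j → y ∈ verticesOf j) (sym same) (∈-verticesOf⁺ y)) x≢y)
    where part∈ = ∈-partsExcept⁺ i≢x

  μ-witness : ∃[ H ] NonEdgeSet (K s m) H × length H ≡ muFormula s m × SameRank (K s m) (K s m ∪E H)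
  μ-witness = edgesOutside zero , edgesOutside-nonEdgeSet zero , trans (length-edgesOutside zero) ∑C2≡muFormula ,
    χ , rankNumber-K , rankNumber-∪E (edgesOutside-offPart zero)

  μ-upper : ∀ H → NonEdgeSet (K s m) H → SameRank (K s m) (K s m ∪E H) → length H ≤ muFormula s m
  μ-upper H (nonedges , H-distinct) (k , rankNumberK , (f , ranking) , _) = begin
    length H                         ≤⟨ length≤-up-to-swap _≟ᵥ_ H-distinct H⊆edgesOutside ⟩
    length (edgesOutside i)          ≡⟨ length-edgesOutside i ⟩
    ∑ (λ j → m (punchIn i j) C 2)    ≤⟨ ∑-punchIn-≤ (λ j → m j C 2) (C2-mono m₀≤mi) ⟩
    ∑ (λ j → m (fsuc j) C 2)         ≡⟨ ∑C2≡muFormula ⟩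
    muFormula s m                    ∎
    where
    open ≤-Reasoning
    rankingK : IsRanking (K s m) k f
    rankingK = IsRanking-∪E⁻ ranking

    k≤χ : k ≤ χ
    k≤χ = proj₂ rankNumberK χ (baseLabel , baseLabel-ranks-K)

    i : Fin (suc s)
    i = proj₁ (twinsPart rankingK)

    twins : TwinsWithin f i
    twins = proj₂ (twinsPart rankingK)

    m₀≤mi : m zero ≤ m i
    m₀≤mi = ≮⇒≥ λ mi<m₀ → ≤⇒≯ k≤χ (small-twinsPart⇒χ< rankingK twins mi<m₀)

    H⊆edgesOutside : ∀ {e} → e ∈ H → e ∈ edgesOutside i ⊎ swap e ∈ edgesOutside i
    H⊆edgesOutside {x , y} e∈H = ∈-edgesOutside⁺ x≢y same λ i≡x →
      ≤⇒≯ k≤χ (split-twinsPart⇒χ< rankingK twins (sym i≡x) (trans (sym same) (sym i≡x))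
                 (adjacent⇒labels-≢ ranking (inj₂ (inj₁ e∈H)) x≢y))
      where
      x≢y = proj₁ (All.lookup nonedges e∈H)
      same = decidable-stable (part x ≟ part y) (proj₂ (All.lookup nonedges e∈H))

theorem4p3 : (s : ℕ) (m : Fin (suc s) → ℕ) →
    (∀ i → 1 ≤ m i) → (∀ i → m i ≤ m zero) →
    (((∀ j → j ≢ zero → m j < m zero) →
        ∀ i → m i ≡ m zero → ∀ (a b : Fin (m i)) → a ≢ b →
          Forbidden (K s m) ((i , a) , (i , b)))
    × (∀ i → i ≢ zero → ∀ (a b : Fin (m i)) → a ≢ b →
          Good (K s m) ((i , a) , (i , b)))
    × IsMu (K s m) (muFormula s m))
theorem4p3 s m nonempty largest₀ =
  largest-part-edge-forbidden ,
  (λ i i≢0 _ _ _ → offPart₀-good (i≢0 , i≢0)) ,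
  (μ-witness , μ-upper)
  where open CompleteMultipartite s m nonempty largest₀
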